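{- If $\Gamma\vdash A$ is derivable, then $FV(A)$ is defined, $FV(A)\vdash A$ is derivable, and $FV(A)\leqslant\Gamma$.
   Context: Variables $x,y,z,\ldots$; $\mathsf{x},\mathsf{y},\mathsf{z}$ range over variables. Terms and substitutions of $\lambda\alpha$: $A,B::=\mathsf{x}\mid AB\mid\lambda\mathsf{x}.A\mid S\circ A$, $S::=[B/\mathsf{x}]\mid W\mathsf{x}\mid\{\mathsf{y}\mathsf{x}\}\mid S_{\mathsf{x}}$; $S_1\circ S_2\circ A$ means $S_1\circ(S_2\circ A)$. A context $\Gamma$ is a pair $G,L$ of a finite set $G$ of variables and a finite list $L$ of variables with repetitions allowed; $\mathsf{x}\in\Gamma$ means $\mathsf{x}\in G$ or $\mathsf{x}$ occurs in $L$; $\Gamma,\mathsf{x}$ denotes $G,(L,\mathsf{x})$; a context with empty list is written $G$. Derivable judgements: $G\vdash\mathsf{x}$ if $\mathsf{x}\in G$; $\Gamma,\mathsf{x}\vdash\mathsf{x}$; from $\Gamma\vdash\mathsf{x}$ infer $\Gamma,\mathsf{y}\vdash\mathsf{x}$ ($\mathsf{x}\neq\mathsf{y}$); from $\Gamma\vdash A$, $\Gamma\vdash B$ infer $\Gamma\vdash AB$; from $\Gamma,\mathsf{x}\vdash A$ infer $\Gamma\vdash\lambda\mathsf{x}.A$; from $\Gamma\vdash S\triangleright\Delta$, $\Delta\vdash A$ infer $\Gamma\vdash S\circ A$; from $\Gamma\vdash B$ infer $\Gamma\vdash[B/\mathsf{x}]\triangleright\Gamma,\mathsf{x}$; $\Gamma,\mathsf{x}\vdash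 W\mathsf{x}\triangleright\Gamma$; $\Gamma,\mathsf{y}\vdash\{\mathsf{y}\mathsf{x}\}\triangleright\Gamma,\mathsf{x}$; from $\Gamma\vdash S\triangleright\Delta$ infer $\Gamma,\mathsf{x}\vdash S_{\mathsf{x}}\triangleright\Delta,\mathsf{x}$. The order $\leqslant$ on contexts is the least partial order such that $G,L<G\cup\{\mathsf{x}\},L$ whenever $\mathsf{x}\notin G$, and $G,L<(G\setminus\{\mathsf{x}\}),L'$ where $L'$ is the list $\mathsf{x}$ followed by $L$. Free variables (partial): $FV(\mathsf{x})=\{\mathsf{x}\}$; $FV(AB)=FV(A)\sqcup FV(B)$; $FV(\lambda\mathsf{x}.A)=O_{\lambda\mathsf{x}}(FV(A))$; $FV(W\mathsf{x}\circ A)=FV(A),\mathsf{x}$; $FV([B/\mathsf{x}]\circ A)=FV((\lambda\mathsf{x}.A)B)$; $FV(\{\mathsf{y}\mathsf{x}\}\circ A)=FV(W\mathsf{y}\circ\lambda\mathsf{x}.A)$; $FV(S_{\mathsf{x}}\circ A)=FV(W\mathsf{x}\circ S\circ\lambda\mathsf{x}.A)$; where $O_{\lambda\mathsf{x}}(\Gamma,\mathsf{x})=\Gamma$, $O_{\lambda\mathsf{x}}(G)=G\setminus\{\mathsf{x}\}$, otherwise undefined; $(\Gamma,\mathsf{x})\sqcup(\Delta,\mathsf{x})=(\Gamma\sqcup\Delta),\mathsf{x}$, $(\Gamma,\mathsf{x})\sqcup G=(\Gamma\sqcup(G\setminus\{\mathsf{x}\})),\mathsf{x}$, $G\sqcup(\Gamma,\mathsf{x})=((G\setminus\{\mathsf{x}\})\sqcup\Gamma),\mathsf{x}$,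 $G_1\sqcup G_2=G_1\cup G_2$, otherwise undefined; anything built from an undefined value is undefined. -}

module Defs where

open import Data.Nat using (ℕ; _≟_)
open import Data.List using (List; []; _∷_; _++_; filter)
open import Data.List.Membership.Propositional using (_∈_; _∉_)
open import Data.Maybe using (Maybe; just; nothing; _>>=_)
open import Data.Product using (_×_; _,_)
open import Relation.Nullary using (¬_; yes; no; ¬?)
open import Relation.Binary.PropositionalEquality using (_≡_; _≢_)

Var : Set
Var = ℕ

mutual
  data Term : Set where
    var : Var → Term
    app : Term → Term → Term
    lam : Var → Term → Term
    _∘_ : Sub → Term → Term

  data Sub : Set where
    [_/_] : Term → Var → Sub
    W     : Var → Sub
    ⟪_,_⟫ : Var → Var → Sub       -- {y x}  (written ⟪ y , x ⟫)
    lift  : Sub → Var → Sub       -- S_x    (written lift S x)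

infixr 5 _∘_

-- Lists of variables, growing to the right:  L , x   is   L ▸ x
data LList : Set where
  ε   : LList
  _▸_ : LList → Var → LList

infixl 5 _▸_

_◂_ : Var → LList → LList
x ◂ ε = ε ▸ x
x ◂ (L ▸ y) = (x ◂ L) ▸ y

-- Finite sets of variables are represented by lists; everything below
-- respects set-equality of the G-component (same members).
FinSet : Set
FinSet = List Var

_∖_ : FinSet → Var → FinSet
G ∖ x = filter (λ z → ¬? (z ≟ x)) G

_∪_ : FinSet → FinSet → FinSet
G₁ ∪ G₂ = G₁ ++ G₂

record Ctx : Set where
  constructor ⟨_∣_⟩
  field
    glob : FinSet
    loc  : LList
open Ctx public

_,,_ : Ctx → Var → Ctx
⟨ G ∣ L ⟩ ,, x = ⟨ G ∣ L ▸ x ⟩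

gctx : FinSet → Ctx
gctx G = ⟨ G ∣ ε ⟩

mutual
  data _⊢_ : Ctx → Term → Set where
    ax-glob : ∀ {G x} → x ∈ G → gctx G ⊢ var x
    ax-loc  : ∀ {Γ x} → (Γ ,, x) ⊢ var x
    weak    : ∀ {Γ x y} → Γ ⊢ var x → x ≢ y → (Γ ,, y) ⊢ var x
    ⊢app    : ∀ {Γ A B} → Γ ⊢ A → Γ ⊢ B → Γ ⊢ app A B
    ⊢lam    : ∀ {Γ x A} → (Γ ,, x) ⊢ A → Γ ⊢ lam x A
    ⊢sub    : ∀ {Γ Δ S A} → Γ ⊢ S ▷ Δ → Δ ⊢ A → Γ ⊢ (S ∘ A)

  data _⊢_▷_ : Ctx → Sub → Ctx → Set where
    ⊢beta : ∀ {Γ B x} → Γ ⊢ B → Γ ⊢ [ B / x ] ▷ (Γ ,, x)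
    ⊢W    : ∀ {Γ x} → (Γ ,, x) ⊢ W x ▷ Γ
    ⊢ren  : ∀ {Γ x y} → (Γ ,, y) ⊢ ⟪ y , x ⟫ ▷ (Γ ,, x)
    ⊢lift : ∀ {Γ Δ S x} → Γ ⊢ S ▷ Δ → (Γ ,, x) ⊢ lift S x ▷ (Δ ,, x)

_≈ˢ_ : FinSet → FinSet → Set
G ≈ˢ G' = ∀ z → (z ∈ G → z ∈ G') × (z ∈ G' → z ∈ G)

_≈ᶜ_ : Ctx → Ctx → Set
Γ ≈ᶜ Δ = (glob Γ ≈ˢ glob Δ) × (loc Γ ≡ loc Δ)

data Step : Ctx → Ctx → Set where
  add  : ∀ {G L x} → x ∉ G → Step ⟨ G ∣ L ⟩ ⟨ (x ∷ []) ∪ G ∣ L ⟩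
  move : ∀ {G L x} → Step ⟨ G ∣ L ⟩ ⟨ G ∖ x ∣ x ◂ L ⟩

-- ⩽ : least partial order containing Step (reflexive–transitive closure,
-- with reflexivity taken up to equality of contexts, i.e. set-equality of G)
data _⩽_ : Ctx → Ctx → Set where
  ⩽-refl : ∀ {Γ Δ} → Γ ≈ᶜ Δ → Γ ⩽ Δ
  ⩽-step : ∀ {Γ Δ Θ} → Step Γ Δ → Δ ⩽ Θ → Γ ⩽ Θ

O : Var → Ctx → Maybe Ctx
O x ⟨ G ∣ ε ⟩ = just ⟨ G ∖ x ∣ ε ⟩
O x ⟨ G ∣ L ▸ y ⟩ with y ≟ x
... | yes _ = just ⟨ G ∣ L ⟩
... | no  _ = nothing

join : FinSet → LList → FinSet → LList → Maybe Ctx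
join G₁ ε        G₂ ε        = just ⟨ G₁ ∪ G₂ ∣ ε ⟩
join G₁ (L₁ ▸ x) G₂ ε        = join G₁ L₁ (G₂ ∖ x) ε >>= λ Θ → just (Θ ,, x)
join G₁ ε        G₂ (L₂ ▸ x) = join (G₁ ∖ x) ε G₂ L₂ >>= λ Θ → just (Θ ,, x)
join G₁ (L₁ ▸ x) G₂ (L₂ ▸ y) with x ≟ y
... | yes _ = join G₁ L₁ G₂ L₂ >>= λ Θ → just (Θ ,, x)
... | no  _ = nothing

_⊔_ : Ctx → Ctx → Maybe Ctx
⟨ G₁ ∣ L₁ ⟩ ⊔ ⟨ G₂ ∣ L₂ ⟩ = join G₁ L₁ G₂ L₂

Oᵐ : Var → Maybe Ctx → Maybe Ctx
Oᵐ x m = m >>= O x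

_⊔ᵐ_ : Maybe Ctx → Maybe Ctx → Maybe Ctx
m₁ ⊔ᵐ m₂ = m₁ >>= λ Γ → m₂ >>= λ Δ → Γ ⊔ Δ

_,,ᵐ_ : Maybe Ctx → Var → Maybe Ctx
m ,,ᵐ x = m >>= λ Γ → just (Γ ,, x)

-- FVsub S m computes FV(S ∘ A) from m = FV(A); the clauses
-- are the paper's equations with FV(λx.A) = O_λx(FV A) unfolded:
--   FV(W x ∘ A)     = FV(A) , x
--   FV([B/x] ∘ A)   = FV((λx.A) B)        = O_λx(FV A) ⊔ FV B
--   FV({y x} ∘ A)   = FV(W y ∘ λx.A)      = O_λx(FV A) , y
--   FV(S_x ∘ A)     = FV(W x ∘ S ∘ λx.A)  = FV(S ∘ λx.A) , x
mutual
  FV : Term → Maybe Ctx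
  FV (var x)   = just ⟨ x ∷ [] ∣ ε ⟩
  FV (app A B) = FV A ⊔ᵐ FV B
  FV (lam x A) = Oᵐ x (FV A)
  FV (S ∘ A)   = FVsub S (FV A)

  FVsub : Sub → Maybe Ctx → Maybe Ctx
  FVsub [ B / x ]   m = Oᵐ x m ⊔ᵐ FV B
  FVsub (W x)       m = m ,,ᵐ x
  FVsub ⟪ y , x ⟫   m = Oᵐ x m ,,ᵐ y
  FVsub (lift S x)  m = FVsub S (Oᵐ x m) ,,ᵐ x

module Submission where

open import Defs
open import Data.Maybe using (just)
open import Data.Product using (Σ; _×_)
open import Relation.Binary.PropositionalEquality using (_≡_)

open import Data.Nat using (_≟_)
open import Data.Nat.Properties using (≟-diag)
open import Data.List using ([]; _∷_)
open import Data.List.Membership.Propositional using (_∈_)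
open import Data.List.Membership.Propositional.Properties
  using (∈-filter⁺; ∈-filter⁻; ∈-++⁺ˡ; ∈-++⁺ʳ; ∈-++⁻)
open import Data.List.Membership.DecPropositional _≟_ using (_∈?_)
open import Data.List.Relation.Unary.Any using (here; there)
open import Data.Product using (_,_)
open import Data.Sum using (_⊎_; inj₁; inj₂)
open import Data.Empty using (⊥-elim)
open import Relation.Nullary using (¬_; yes; no; ¬?)
open import Relation.Binary.PropositionalEquality
  using (refl; sym; trans; cong; subst; _≢_)

-- The order ⩽ is generated by single steps, which is awkward
-- to induct over.  We therefore work with an explicit characterisation
--   Δ ≼ Γ  :⇔  loc Γ = M ++ loc Δ  for some list M, and every global
--              variable of Δ is global in Γ or occurs in M,
-- i.e. Γ arises from Δ by moving some globals into the front of the list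
-- and adding globals.

data _∈ₗ_ : Var → LList → Set where
  hd : ∀ {x L} → x ∈ₗ (L ▸ x)
  tl : ∀ {x y L} → x ∈ₗ L → x ∈ₗ (L ▸ y)

_++ₗ_ : LList → LList → LList
M ++ₗ ε = M
M ++ₗ (L ▸ x) = (M ++ₗ L) ▸ x

++ₗ-identityˡ : ∀ L → ε ++ₗ L ≡ L
++ₗ-identityˡ ε = refl
++ₗ-identityˡ (L ▸ x) = cong (_▸ x) (++ₗ-identityˡ L)

++ₗ-assoc : ∀ A B C → A ++ₗ (B ++ₗ C) ≡ (A ++ₗ B) ++ₗ C
++ₗ-assoc A B ε = refl
++ₗ-assoc A B (C ▸ x) = cong (_▸ x) (++ₗ-assoc A B C)

◂-++ₗ : ∀ M y L → M ++ₗ (y ◂ L) ≡ (M ▸ y) ++ₗ L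
◂-++ₗ M y ε = refl
◂-++ₗ M y (L ▸ x) = cong (_▸ x) (◂-++ₗ M y L)

∈ₗ-++⁺ˡ : ∀ {z} A B → z ∈ₗ A → z ∈ₗ (A ++ₗ B)
∈ₗ-++⁺ˡ A ε p = p
∈ₗ-++⁺ˡ A (B ▸ x) p = tl (∈ₗ-++⁺ˡ A B p)

∈ₗ-++⁺ʳ : ∀ {z} A B → z ∈ₗ B → z ∈ₗ (A ++ₗ B)
∈ₗ-++⁺ʳ A (B ▸ x) hd = hd
∈ₗ-++⁺ʳ A (B ▸ x) (tl p) = tl (∈ₗ-++⁺ʳ A B p)

▸-injective : ∀ {L K x y} → (L ▸ x) ≡ (K ▸ y) → (L ≡ K) × (x ≡ y)
▸-injective refl = refl , refl

∈-∖⁺ : ∀ {z x G} → z ∈ G → z ≢ x → z ∈ G ∖ x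
∈-∖⁺ {x = x} = ∈-filter⁺ (λ w → ¬? (w ≟ x))

∈-∖⁻ : ∀ {z x G} → z ∈ G ∖ x → (z ∈ G) × (z ≢ x)
∈-∖⁻ {x = x} = ∈-filter⁻ (λ w → ¬? (w ≟ x))

Covers : FinSet → LList → FinSet → Set
Covers G M H = ∀ z → z ∈ H → (z ∈ G) ⊎ (z ∈ₗ M)

covers-refl : ∀ {G M} → Covers G M G
covers-refl z p = inj₁ p

covers-tl : ∀ {G M H y} → Covers G M H → Covers G (M ▸ y) H
covers-tl f z p with f z p
... | inj₁ q = inj₁ q
... | inj₂ q = inj₂ (tl q)

covers-∖ : ∀ {G M H x} → Covers G (M ▸ x) H → Covers G M (H ∖ x)
covers-∖ {H = H} f z p with ∈-∖⁻ {G = H} p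
... | q , z≢x with f z q
... | inj₁ r = inj₁ r
... | inj₂ hd = ⊥-elim (z≢x refl)
... | inj₂ (tl r) = inj₂ r

covers-▸∖ : ∀ {G M H x} → Covers G M (H ∖ x) → Covers G (M ▸ x) H
covers-▸∖ {x = x} f z p with z ≟ x
... | yes refl = inj₂ hd
... | no z≢x = covers-tl f z (∈-∖⁺ p z≢x)

covers-trans : ∀ {G₁ G₂ M₁ M₂ H} →
  Covers G₂ M₂ G₁ → Covers G₁ M₁ H → Covers G₂ (M₂ ++ₗ M₁) H
covers-trans {M₁ = M₁} {M₂} f₂ f₁ z p with f₁ z p
... | inj₂ q = inj₂ (∈ₗ-++⁺ʳ M₂ M₁ q)
... | inj₁ q with f₂ z q
... | inj₁ r = inj₁ r
... | inj₂ r = inj₂ (∈ₗ-++⁺ˡ M₂ M₁ r)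

record _≼_ (Δ Γ : Ctx) : Set where
  constructor mk≼
  field
    prefix : LList
    loc-≡  : loc Γ ≡ prefix ++ₗ loc Δ
    covers : Covers (glob Γ) prefix (glob Δ)

≼-refl : ∀ Δ → Δ ≼ Δ
≼-refl Δ = mk≼ ε (sym (++ₗ-identityˡ (loc Δ))) covers-refl

≼-trans : ∀ {Δ₁ Δ₂ Δ₃} → Δ₁ ≼ Δ₂ → Δ₂ ≼ Δ₃ → Δ₁ ≼ Δ₃
≼-trans {Δ₁} (mk≼ M₁ e₁ f₁) (mk≼ M₂ e₂ f₂) =
  mk≼ (M₂ ++ₗ M₁)
      (trans e₂ (trans (cong (M₂ ++ₗ_) e₁) (++ₗ-assoc M₂ M₁ (loc Δ₁))))
      (covers-trans f₂ f₁)

≼-extend : ∀ {Δ Γ} x → Δ ≼ Γ → (Δ ,, x) ≼ (Γ ,, x)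
≼-extend x (mk≼ M eq f) = mk≼ M (cong (_▸ x) eq) f

var-visible : ∀ G M x → (x ∈ G) ⊎ (x ∈ₗ M) → ⟨ G ∣ M ⟩ ⊢ var x
var-visible G ε x (inj₁ p) = ax-glob p
var-visible G ε x (inj₂ ())
var-visible G (M ▸ y) x h with x ≟ y
... | yes refl = ax-loc {Γ = ⟨ G ∣ M ⟩}
... | no x≢y = weak (var-visible G M x (drop-last h)) x≢y
  where
  drop-last : (x ∈ G) ⊎ (x ∈ₗ (M ▸ y)) → (x ∈ G) ⊎ (x ∈ₗ M)
  drop-last (inj₁ p) = inj₁ p
  drop-last (inj₂ hd) = ⊥-elim (x≢y refl)
  drop-last (inj₂ (tl q)) = inj₂ q

mutual
  weaken : ∀ {Γ A} → Γ ⊢ A → (Γ' : Ctx) → Γ ≼ Γ' → Γ' ⊢ A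
  weaken (ax-glob {x = x} p) ⟨ G' ∣ _ ⟩ (mk≼ M refl f) = var-visible G' M x (f x p)
  weaken (ax-loc {Γ}) ⟨ G' ∣ _ ⟩ (mk≼ M refl f) = ax-loc {Γ = ⟨ G' ∣ M ++ₗ loc Γ ⟩}
  weaken (weak {Γ} d x≢y) ⟨ G' ∣ _ ⟩ (mk≼ M refl f) =
    weak {Γ = ⟨ G' ∣ M ++ₗ loc Γ ⟩} (weaken d ⟨ G' ∣ M ++ₗ loc Γ ⟩ (mk≼ M refl f)) x≢y
  weaken (⊢app d e) Γ' l = ⊢app (weaken d Γ' l) (weaken e Γ' l)
  weaken (⊢lam {x = x} d) Γ' l = ⊢lam (weaken d (Γ' ,, x) (≼-extend x l))
  weaken (⊢sub s d) Γ' l with weaken▷ s Γ' l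
  ... | Δ' , s' , l' = ⊢sub s' (weaken d Δ' l')

  weaken▷ : ∀ {Γ S Δ} → Γ ⊢ S ▷ Δ → (Γ' : Ctx) → Γ ≼ Γ' →
    Σ Ctx λ Δ' → (Γ' ⊢ S ▷ Δ') × (Δ ≼ Δ')
  weaken▷ (⊢beta {x = x} b) Γ' l = (Γ' ,, x) , ⊢beta (weaken b Γ' l) , ≼-extend x l
  weaken▷ (⊢W {Γ}) ⟨ G' ∣ _ ⟩ (mk≼ M refl f) =
    ⟨ G' ∣ M ++ₗ loc Γ ⟩ , ⊢W {Γ = ⟨ G' ∣ M ++ₗ loc Γ ⟩} , mk≼ M refl f
  weaken▷ (⊢ren {Γ} {x}) ⟨ G' ∣ _ ⟩ (mk≼ M refl f) =
    ⟨ G' ∣ (M ++ₗ loc Γ) ▸ x ⟩ , ⊢ren {Γ = ⟨ G' ∣ M ++ₗ loc Γ ⟩} , mk≼ M refl f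
  weaken▷ (⊢lift {Γ} {x = x} s) ⟨ G' ∣ _ ⟩ (mk≼ M refl f)
    with weaken▷ s ⟨ G' ∣ M ++ₗ loc Γ ⟩ (mk≼ M refl f)
  ... | Δ' , s' , l' = (Δ' ,, x) , ⊢lift {Γ = ⟨ G' ∣ M ++ₗ loc Γ ⟩} s' , ≼-extend x l'

O-▸ : ∀ x G L → O x ⟨ G ∣ L ▸ x ⟩ ≡ just ⟨ G ∣ L ⟩
O-▸ x G L rewrite ≟-diag (refl {x = x}) = refl

O-below : ∀ Θ Γ x → Θ ≼ (Γ ,, x) →
  Σ Ctx λ Θ' → (O x Θ ≡ just Θ') × (Θ' ≼ Γ) × (Θ ≼ (Θ' ,, x))
O-below ⟨ G' ∣ ε ⟩ ⟨ G ∣ L ⟩ x (mk≼ _ refl f) =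
  ⟨ G' ∖ x ∣ ε ⟩ , refl , mk≼ L refl (covers-∖ f) , mk≼ (ε ▸ x) refl (covers-▸∖ covers-refl)
O-below ⟨ G' ∣ L' ▸ _ ⟩ ⟨ G ∣ _ ⟩ x (mk≼ M refl f) =
  ⟨ G' ∣ L' ⟩ , O-▸ x G' L' , mk≼ M refl f , ≼-refl _

JoinBelow : Ctx → Ctx → Ctx → Set
JoinBelow Δ₁ Δ₂ Γ = Σ Ctx λ Ξ →
  ((Δ₁ ⊔ Δ₂) ≡ just Ξ) × (Δ₁ ≼ Ξ) × (Δ₂ ≼ Ξ) × (Ξ ≼ Γ)

join-below : ∀ G N G₁ L₁ G₂ L₂ → ⟨ G₁ ∣ L₁ ⟩ ≼ ⟨ G ∣ N ⟩ → ⟨ G₂ ∣ L₂ ⟩ ≼ ⟨ G ∣ N ⟩ →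
  JoinBelow ⟨ G₁ ∣ L₁ ⟩ ⟨ G₂ ∣ L₂ ⟩ ⟨ G ∣ N ⟩
join-below G N G₁ ε G₂ ε (mk≼ M₁ refl f₁) (mk≼ M₂ refl f₂) =
  ⟨ G₁ ∪ G₂ ∣ ε ⟩ , refl ,
  mk≼ ε refl (λ z p → inj₁ (∈-++⁺ˡ p)) ,
  mk≼ ε refl (λ z p → inj₁ (∈-++⁺ʳ G₁ p)) ,
  mk≼ N refl covers-∪
  where
  covers-∪ : Covers G N (G₁ ∪ G₂)
  covers-∪ z p with ∈-++⁻ G₁ p
  ... | inj₁ q = f₁ z q
  ... | inj₂ q = f₂ z q
join-below G N G₁ (L₁ ▸ x) G₂ ε (mk≼ M₁ refl f₁) (mk≼ _ refl f₂)
  with join-below G (M₁ ++ₗ L₁) G₁ L₁ (G₂ ∖ x) ε (mk≼ M₁ refl f₁) (mk≼ _ refl (covers-∖ f₂))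
... | ⟨ G₃ ∣ L₃ ⟩ , eq , l₁ , mk≼ M e h , l₃ rewrite eq =
  ⟨ G₃ ∣ L₃ ▸ x ⟩ , refl , ≼-extend x l₁ , mk≼ (M ▸ x) (cong (_▸ x) e) (covers-▸∖ h) ,
  ≼-extend x l₃
join-below G N G₁ ε G₂ (L₂ ▸ x) (mk≼ _ refl f₁) (mk≼ M₂ refl f₂)
  with join-below G (M₂ ++ₗ L₂) (G₁ ∖ x) ε G₂ L₂ (mk≼ _ refl (covers-∖ f₁)) (mk≼ M₂ refl f₂)
... | ⟨ G₃ ∣ L₃ ⟩ , eq , mk≼ M e h , l₂ , l₃ rewrite eq =
  ⟨ G₃ ∣ L₃ ▸ x ⟩ , refl , mk≼ (M ▸ x) (cong (_▸ x) e) (covers-▸∖ h) , ≼-extend x l₂ ,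
  ≼-extend x l₃
join-below G N G₁ (L₁ ▸ x) G₂ (L₂ ▸ y) (mk≼ M₁ refl f₁) (mk≼ M₂ e f₂)
  with ▸-injective e
... | e' , refl rewrite ≟-diag (refl {x = x})
  with join-below G (M₁ ++ₗ L₁) G₁ L₁ G₂ L₂ (mk≼ M₁ refl f₁) (mk≼ M₂ e' f₂)
... | Ξ , eq , l₁ , l₂ , l₃ rewrite eq =
  (Ξ ,, x) , refl , ≼-extend x l₁ , ≼-extend x l₂ , ≼-extend x l₃

-- The content of the theorem with ≼ in place of ⩽, for terms and, for a
-- substitution S : Γ ▷ Δ, relative to a context Θ ≼ Δ standing for FV(A).
FVBelow : Ctx → Term → Set
FVBelow Γ A = Σ Ctx λ Δ → (FV A ≡ just Δ) × (Δ ⊢ A) × (Δ ≼ Γ)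

FVsubBelow : Ctx → Sub → Ctx → Set
FVsubBelow Γ S Θ = Σ Ctx λ Ξ → (FVsub S (just Θ) ≡ just Ξ) ×
  Σ Ctx λ Δ' → (Ξ ⊢ S ▷ Δ') × (Θ ≼ Δ') × (Ξ ≼ Γ)

mutual
  fv-below : ∀ {Γ A} → Γ ⊢ A → FVBelow Γ A
  fv-below (ax-glob p) =
    _ , refl , ax-glob (here refl) , mk≼ ε refl (λ { z (here refl) → inj₁ p })
  fv-below (ax-loc {Γ}) =
    _ , refl , ax-glob (here refl) , mk≼ (loc Γ ▸ _) refl (λ { z (here refl) → inj₂ hd })
  fv-below (weak d _) with fv-below d
  ... | Δ , refl , d' , mk≼ M e f = Δ , refl , d' , mk≼ (M ▸ _) (cong (_▸ _) e) (covers-tl f)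
  fv-below {Γ} (⊢app d e) with fv-below d | fv-below e
  ... | Δ₁ , e₁ , d₁ , l₁ | Δ₂ , e₂ , d₂ , l₂ rewrite e₁ | e₂
    with join-below (glob Γ) (loc Γ) (glob Δ₁) (loc Δ₁) (glob Δ₂) (loc Δ₂) l₁ l₂
  ... | Ξ , eq , j₁ , j₂ , j₃ = Ξ , eq , ⊢app (weaken d₁ Ξ j₁) (weaken d₂ Ξ j₂) , j₃
  fv-below {Γ} (⊢lam {x = x} d) with fv-below d
  ... | Θ , e , d' , l rewrite e with O-below Θ Γ x l
  ... | Θ' , eO , l₁ , l₂ = Θ' , eO , ⊢lam (weaken d' (Θ' ,, x) l₂) , l₁
  fv-below (⊢sub s d) with fv-below d
  ... | Θ , e , d' , l rewrite e with fvsub-below s Θ l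
  ... | Ξ , eS , Δ' , s' , l₁ , l₂ = Ξ , eS , ⊢sub s' (weaken d' Δ' l₁) , l₂

  fvsub-below : ∀ {Γ S Δ} → Γ ⊢ S ▷ Δ → (Θ : Ctx) → Θ ≼ Δ → FVsubBelow Γ S Θ
  fvsub-below {Γ} (⊢beta {x = x} b) Θ l with O-below Θ Γ x l | fv-below b
  ... | Θ' , eO , l₁ , l₂ | Φ , eB , dB , lB rewrite eO | eB
    with join-below (glob Γ) (loc Γ) (glob Θ') (loc Θ') (glob Φ) (loc Φ) l₁ lB
  ... | Ξ , eq , j₁ , j₂ , j₃ =
    Ξ , eq , (Ξ ,, x) , ⊢beta (weaken dB Ξ j₂) , ≼-trans l₂ (≼-extend x j₁) , j₃
  fvsub-below (⊢W {x = x}) Θ l = (Θ ,, x) , refl , Θ , ⊢W , ≼-refl Θ , ≼-extend x l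
  fvsub-below (⊢ren {Γ} {x} {y}) Θ l with O-below Θ Γ x l
  ... | Θ' , eO , l₁ , l₂ rewrite eO = (Θ' ,, y) , refl , (Θ' ,, x) , ⊢ren , l₂ , ≼-extend y l₁
  fvsub-below (⊢lift {Δ = Δ} {x = x} s) Θ l with O-below Θ Δ x l
  ... | Θ' , eO , l₁ , l₂ rewrite eO with fvsub-below s Θ' l₁
  ... | Ξ , e , Δ'' , s' , l₃ , l₄ rewrite e =
    (Ξ ,, x) , refl , (Δ'' ,, x) , ⊢lift s' , ≼-trans l₂ (≼-extend x l₃) , ≼-extend x l₄

-- From ≼ to ⩽.  The order ⩽ is built by prepending steps, so both lemmas
-- below say: to reach Θ from ⟨ H ∣ L ⟩ it suffices to reach Θ from the
-- context obtained after a batch of steps.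

removeAll : FinSet → LList → FinSet
removeAll H ε = H
removeAll H (M ▸ y) = removeAll (H ∖ y) M

removeAll⁻ : ∀ {z} H M → z ∈ removeAll H M → (z ∈ H) × ¬ (z ∈ₗ M)
removeAll⁻ H ε p = p , λ ()
removeAll⁻ {z} H (M ▸ y) p with removeAll⁻ (H ∖ y) M p
... | q , z∉M with ∈-∖⁻ {G = H} q
... | r , z≢y = r , z∉M▸y
  where
  z∉M▸y : ¬ (z ∈ₗ (M ▸ y))
  z∉M▸y hd = z≢y refl
  z∉M▸y (tl t) = z∉M t

moves : ∀ M H L Θ → ⟨ removeAll H M ∣ M ++ₗ L ⟩ ⩽ Θ → ⟨ H ∣ L ⟩ ⩽ Θ
moves ε H L Θ p = subst (λ K → ⟨ H ∣ K ⟩ ⩽ Θ) (++ₗ-identityˡ L) p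
moves (M ▸ y) H L Θ p =
  ⩽-step move (moves M (H ∖ y) (y ◂ L) Θ
    (subst (λ K → ⟨ removeAll (H ∖ y) M ∣ K ⟩ ⩽ Θ) (sym (◂-++ₗ M y L)) p))

insertAll : FinSet → FinSet → FinSet
insertAll H [] = H
insertAll H (k ∷ K) with k ∈? H
... | yes _ = insertAll H K
... | no _ = insertAll (k ∷ H) K

insertAll⁺ˡ : ∀ {z} H K → z ∈ H → z ∈ insertAll H K
insertAll⁺ˡ H [] p = p
insertAll⁺ˡ H (k ∷ K) p with k ∈? H
... | yes _ = insertAll⁺ˡ H K p
... | no _ = insertAll⁺ˡ (k ∷ H) K (there p)

insertAll⁺ʳ : ∀ {z} H K → z ∈ K → z ∈ insertAll H K
insertAll⁺ʳ H (k ∷ K) p with k ∈? H | p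
... | yes k∈H | here refl = insertAll⁺ˡ H K k∈H
... | yes _ | there q = insertAll⁺ʳ H K q
... | no _ | here refl = insertAll⁺ˡ (k ∷ H) K (here refl)
... | no _ | there q = insertAll⁺ʳ (k ∷ H) K q

insertAll⁻ : ∀ {z} H K → z ∈ insertAll H K → (z ∈ H) ⊎ (z ∈ K)
insertAll⁻ H [] p = inj₁ p
insertAll⁻ H (k ∷ K) p with k ∈? H
... | yes _ with insertAll⁻ H K p
...   | inj₁ q = inj₁ q
...   | inj₂ q = inj₂ (there q)
insertAll⁻ H (k ∷ K) p | no _ with insertAll⁻ (k ∷ H) K p
...   | inj₁ (here q) = inj₂ (here q)
...   | inj₁ (there q) = inj₁ q
...   | inj₂ q = inj₂ (there q)

adds : ∀ K H L Θ → ⟨ insertAll H K ∣ L ⟩ ⩽ Θ → ⟨ H ∣ L ⟩ ⩽ Θ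
adds [] H L Θ p = p
adds (k ∷ K) H L Θ p with k ∈? H
... | yes _ = adds K H L Θ p
... | no k∉H = ⩽-step (add k∉H) (adds K (k ∷ H) L Θ p)

-- Δ ≼ Γ gives Δ ⩽ Γ: move the prefix M, then add the globals of Γ; the
-- globals reached are those of Γ, since Δ's remaining globals are covered.
≼⇒⩽ : ∀ {Δ Γ} → Δ ≼ Γ → Δ ⩽ Γ
≼⇒⩽ {⟨ G₀ ∣ L ⟩} {⟨ G ∣ _ ⟩} (mk≼ M refl f) =
  moves M G₀ L _ (adds G H (M ++ₗ L) _ (⩽-refl ((λ z → to z , insertAll⁺ʳ H G) , refl)))
  where
  H : FinSet
  H = removeAll G₀ M

  to : ∀ z → z ∈ insertAll H G → z ∈ G
  to z p with insertAll⁻ H G p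
  ... | inj₂ q = q
  ... | inj₁ q with removeAll⁻ G₀ M q
  ... | r , z∉M with f z r
  ... | inj₁ t = t
  ... | inj₂ t = ⊥-elim (z∉M t)

mainTheorem7 : (Γ : Ctx) (A : Term) → Γ ⊢ A →
    Σ Ctx (λ Δ → (FV A ≡ just Δ) × (Δ ⊢ A) × (Δ ⩽ Γ))
mainTheorem7 Γ A d with fv-below d
... | Δ , fv≡Δ , Δ⊢A , Δ≼Γ = Δ , fv≡Δ , Δ⊢A , ≼⇒⩽ Δ≼Γ
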